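{- Let $R$ be a finite set of positive integers with $\min(R)=m\ge 2$ and $\max(R)=M$. Then for every fixed graph $G$ and every $n$, $$\max_{r\in R}\hat{\mathrm{ex}}_r(n,G)\;\le\;\hat{\mathrm{ex}}_R(n,G)\;\le\;\frac{\binom{M}{2}}{\binom{m}{2}}\,\hat{\mathrm{ex}}_m(n,G).$$
   Context: For a finite set $R$ of positive integers, an $R$-graph (or $R$-uniform hypergraph) is a hypergraph $\mathcal{H}=(V,E)$ in which the cardinality of every edge belongs to $R$; a $k$-graph is a $\{k\}$-graph. The (2-)shadow $\partial(\mathcal{H})$ of a hypergraph $\mathcal{H}$ is the simple graph on $V(\mathcal{H})$ in which $uv$ is an edge iff $\{u,v\}\subseteq h$ for some edge $h$ of $\mathcal{H}$. For a simple graph $G$, a hypergraph $\mathcal{H}$ is a Berge-$G$ if there is an injection $i:V(G)\to V(\mathcal{H})$ and a bijection $f:E(G)\to E(\mathcal{H})$ with $\{i(u),i(v)\}\subseteq f(uv)$ for every edge $uv\in E(G)$; $\mathcal{H}$ is Berge-$G$-free if it has no subhypergraph that is a Berge-$G$. The cover Turán number $\hat{\mathrm{ex}}_R(n,G)$ is the maximum number of edges in $\partial(\mathcal{H})$ over all Berge-$G$-free $R$-graphs $\mathcal{H}$ on $n$ vertices; $\hat{\mathrm{ex}}_r(n,G)$ denotes $\hat{\mathrm{ex}}_{\{r\}}(n,G)$. -}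

module Defs where

open import Data.Nat using (ℕ; _≤_; _<_)
open import Data.Nat.Properties using (_<?_)
open import Data.Fin using (Fin; toℕ)
open import Data.Fin.Subset using (Subset; _∈_; ∣_∣)
open import Data.Fin.Subset.Properties using (_∈?_)
open import Data.List using (List; length; allFin; filter; lookup; cartesianProduct)
open import Data.List.Membership.Propositional using () renaming (_∈_ to _∈ₗ_)
open import Data.List.Relation.Unary.All using (All)
open import Data.List.Relation.Unary.Any using (Any; any?)
open import Data.List.Relation.Unary.Unique.Propositional using (Unique)
open import Data.Product using (Σ; _×_; _,_; ∃; proj₁; proj₂)
open import Data.Product.Properties using ()
open import Relation.Nullary.Decidable using (_×-dec_)
open import Function.Definitions using (Injective)
open import Relation.Binary.PropositionalEquality using (_≡_)

record Hypergraph (n : ℕ) : Set where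
  constructor hypergraph
  field
    edges  : List (Subset n)
    simple : Unique edges
open Hypergraph public

record Graph : Set where
  constructor graph
  field
    order   : ℕ
    gedges  : List (Subset order)
    gsimple : Unique gedges
    gtwo    : All (λ e → ∣ e ∣ ≡ 2) gedges
open Graph public

IsRGraph : {n : ℕ} → List ℕ → Hypergraph n → Set
IsRGraph R H = All (λ h → ∣ h ∣ ∈ₗ R) (edges H)

ContainsBerge : {n : ℕ} → (G : Graph) → Hypergraph n → Set
ContainsBerge {n} G H =
  Σ (Fin (order G) → Fin n) λ i →
  Σ (Fin (length (gedges G)) → Fin (length (edges H))) λ f →
    Injective _≡_ _≡_ i × Injective _≡_ _≡_ f ×
    (∀ j (u : Fin (order G)) → u ∈ lookup (gedges G) j → i u ∈ lookup (edges H) (f j))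

BergeFree : {n : ℕ} → Graph → Hypergraph n → Set
BergeFree G H = ContainsBerge G H → Data.Empty.⊥
  where import Data.Empty

InShadow : {n : ℕ} → Hypergraph n → Fin n × Fin n → Set
InShadow H (u , v) = Any (λ h → u ∈ h × v ∈ h) (edges H)

pairsLt : (n : ℕ) → List (Fin n × Fin n)
pairsLt n = filter (λ p → toℕ (proj₁ p) <? toℕ (proj₂ p)) (cartesianProduct (allFin n) (allFin n))

shadowSize : {n : ℕ} → Hypergraph n → ℕ
shadowSize H = length (filter inSh? (pairsLt _))
  where
  inSh? : ∀ p → Relation.Nullary.Decidable.Dec (InShadow H p)
  inSh? (u , v) = any? (λ h → (u ∈? h) ×-dec (v ∈? h)) (edges H)

-- k is the cover Turán number ex̂_R(n,G): the maximum of |∂H| over all Berge-G-free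
-- R-graphs H on n vertices (the maximum exists: the edgeless hypergraph qualifies,
-- and there are finitely many hypergraphs on Fin n).
IsCoverTuran : List ℕ → ℕ → Graph → ℕ → Set
IsCoverTuran R n G k =
  (Σ (Hypergraph n) λ H → IsRGraph R H × BergeFree G H × shadowSize H ≡ k) ×
  (∀ (H : Hypergraph n) → IsRGraph R H → BergeFree G H → shadowSize H ≤ k)

-- Part one holds because an r-graph with r ∈ R is an R-graph. For part two, shrink every
-- edge h of an extremal Berge-G-free R-graph H to an m-subset h' ⊆ h. Charge each shadow
-- pair to the first edge containing it. Deleting from h a vertex of least degree in the
-- graph of pairs charged to h keeps at least a C(s-1,2)/C(s,2) fraction of them, where
-- s = |h|, so h' keeps at least a C(m,2)/C(|h|,2) ≥ C(m,2)/C(M,2) fraction. Without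
-- duplicates the shrunken edges form an m-graph whose edges sit inside distinct edges of
-- H, so it is still Berge-G-free, and its shadow contains every kept pair.

module Submission where

open import Defs
open import Data.Bool using (Bool; true; false; _∧_; _∨_; not; T)
import Data.Bool as Bool
open import Data.Bool.Properties using (T-∧)
open import Data.Nat using (ℕ; zero; suc; _+_; _*_; _∸_; _≤_; _<_; z≤n; s≤s; _≤?_; >-nonZero)
open import Data.Nat.Properties
open import Data.Nat.Combinatorics using (_C_; nC1≡n; nCk+nC[k+1]≡[n+1]C[k+1])
open import Data.Nat.Tactic.RingSolver using (solve-∀)
open import Data.Fin using (Fin; zero; suc)
import Data.Fin.Properties as Fin
open import Data.Fin.Subset using (Subset; inside; outside; _-_; _⊆_; ∣_∣) renaming (_∈_ to _∈ₛ_)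
open import Data.Fin.Subset.Properties using (_∈?_; p─⊥≡p; p─q⊆p; x∈p∧x≢y⇒x∈p-y; ⊆-reflexive)
open import Data.Vec using (here; there)
import Data.Vec as Vec
open import Data.Vec.Properties using (≡-dec)
open import Data.Vec.Functional using (Vector)
open import Data.List using (List; []; _∷_; [_]; length; lookup; filter; deduplicate)
open import Data.List.Membership.Propositional using (_∈_)
open import Data.List.Membership.Propositional.Properties using (∈-lookup)
open import Data.List.Relation.Binary.Subset.Propositional using () renaming (_⊆_ to _⊆ₗ_)
open import Data.List.Relation.Unary.All using (All; []; _∷_)
import Data.List.Relation.Unary.All as All
import Data.List.Relation.Unary.All.Properties as All
open import Data.List.Relation.Unary.Any using (here; any?; index)
import Data.List.Relation.Unary.Any.Properties as Any
open import Data.List.Relation.Unary.Unique.Propositional using (Unique; _∷_)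
open import Data.List.Relation.Unary.Unique.DecPropositional.Properties using (deduplicate-!)
open import Data.Product using (∃; _×_; _,_; proj₁; proj₂)
import Data.Product as Product
open import Data.Empty using (⊥-elim)
open import Function using (_∘_; id; Equivalence)
open import Function.Definitions using (Injective)
open import Relation.Nullary using (Dec; does; yes; no)
open import Relation.Nullary.Decidable using (_×-dec_)
open import Relation.Unary using (Decidable)
open import Relation.Binary.Definitions using (DecidableEquality)
open import Relation.Binary.PropositionalEquality hiding ([_])
open import Algebra.Properties.CommutativeSemigroup *-commutativeSemigroup using (x∙yz≈y∙xz; xy∙z≈xz∙y)
open import Algebra.Properties.Semiring.Sum +-*-semiring
  using (sum; sum-syntax; sum-replicate-zero; sum-cong-≗; ∑-distrib-+; ∑-comm; *-distribˡ-sum; *-distribʳ-sum)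

⟦_⟧ : Bool → ℕ
⟦ true ⟧ = 1
⟦ false ⟧ = 0

⟦b⟧≤1 : ∀ b → ⟦ b ⟧ ≤ 1
⟦b⟧≤1 true = ≤-refl
⟦b⟧≤1 false = z≤n

T⇒⟦not⟧≡0 : ∀ {b} → T b → ⟦ not b ⟧ ≡ 0
T⇒⟦not⟧≡0 {true} _ = refl

T⇒⟦⟧≤ : ∀ {a b} → (T a → T b) → ⟦ a ⟧ ≤ ⟦ b ⟧
T⇒⟦⟧≤ {false} _ = z≤n
T⇒⟦⟧≤ {true} {true} _ = ≤-refl
T⇒⟦⟧≤ {true} {false} a⇒b = ⊥-elim (a⇒b _)

T-does⇒A : ∀ {A : Set} (a? : Dec A) → T (does a?) → A
T-does⇒A (yes a) _ = a

A⇒T-does : ∀ {A : Set} (a? : Dec A) → A → T (does a?)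
A⇒T-does (yes _) _ = _
A⇒T-does (no ¬a) a = ¬a a

⟦q∧a⟧≡⟦q∧b⟧+⟦q∧a∧¬b⟧ : ∀ q a b → (T b → T a) → ⟦ q ∧ a ⟧ ≡ ⟦ q ∧ b ⟧ + ⟦ (q ∧ a) ∧ not b ⟧
⟦q∧a⟧≡⟦q∧b⟧+⟦q∧a∧¬b⟧ false a b _ = refl
⟦q∧a⟧≡⟦q∧b⟧+⟦q∧a∧¬b⟧ true true true _ = refl
⟦q∧a⟧≡⟦q∧b⟧+⟦q∧a∧¬b⟧ true true false _ = refl
⟦q∧a⟧≡⟦q∧b⟧+⟦q∧a∧¬b⟧ true false true b⇒a = ⊥-elim (b⇒a _)
⟦q∧a⟧≡⟦q∧b⟧+⟦q∧a∧¬b⟧ true false false _ = refl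

⟦q∧[a∨b]⟧≡⟦q∧a⟧+⟦q∧¬a∧b⟧ : ∀ q a b → ⟦ q ∧ (a ∨ b) ⟧ ≡ ⟦ q ∧ a ⟧ + ⟦ (q ∧ not a) ∧ b ⟧
⟦q∧[a∨b]⟧≡⟦q∧a⟧+⟦q∧¬a∧b⟧ false a b = refl
⟦q∧[a∨b]⟧≡⟦q∧a⟧+⟦q∧¬a∧b⟧ true true b = refl
⟦q∧[a∨b]⟧≡⟦q∧a⟧+⟦q∧¬a∧b⟧ true false b = refl

T-[q∧¬a]∧c-antitone : ∀ q c {a a'} → (T a' → T a) → T ((q ∧ not a) ∧ c) → T ((q ∧ not a') ∧ c)
T-[q∧¬a]∧c-antitone true c {false} {false} _ t = t
T-[q∧¬a]∧c-antitone true c {false} {true} a'⇒a _ = ⊥-elim (a'⇒a _)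

∑-mono-≤ : ∀ {k} {f g : Vector ℕ k} → (∀ i → f i ≤ g i) → sum f ≤ sum g
∑-mono-≤ {zero} f≤g = z≤n
∑-mono-≤ {suc k} f≤g = +-mono-≤ (f≤g zero) (∑-mono-≤ (λ i → f≤g (suc i)))

∑-δ : ∀ {n} (u : Fin n) → ∑[ w < n ] ⟦ does (u Fin.≟ w) ⟧ ≡ 1
∑-δ {suc n} zero = cong suc (sum-replicate-zero n)
∑-δ {suc n} (suc u) = ∑-δ u

∣p∣≡∑ : ∀ {n} (p : Subset n) → ∣ p ∣ ≡ ∑[ w < n ] ⟦ does (w ∈? p) ⟧
∣p∣≡∑ Vec.[] = refl
∣p∣≡∑ (inside Vec.∷ p) = cong suc (∣p∣≡∑ p)
∣p∣≡∑ (outside Vec.∷ p) = ∣p∣≡∑ p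

x∈p⇒∣p-x∣+1≡∣p∣ : ∀ {n} {x : Fin n} {p : Subset n} → x ∈ₛ p → suc ∣ p - x ∣ ≡ ∣ p ∣
x∈p⇒∣p-x∣+1≡∣p∣ {p = inside Vec.∷ p} here = cong suc (cong ∣_∣ (p─⊥≡p p))
x∈p⇒∣p-x∣+1≡∣p∣ {p = inside Vec.∷ p} (there x∈p) = cong suc (x∈p⇒∣p-x∣+1≡∣p∣ x∈p)
x∈p⇒∣p-x∣+1≡∣p∣ {p = outside Vec.∷ p} (there x∈p) = x∈p⇒∣p-x∣+1≡∣p∣ x∈p

∃-below-average : ∀ {n} (h : Subset n) (d : Fin n → ℕ) {s} → 0 < ∣ h ∣ → sum d ≤ s →
  ∃ λ w → w ∈ₛ h × d w * ∣ h ∣ ≤ s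
∃-below-average h d {s} 0<∣h∣ ∑d≤s
  with Fin.any? (λ w → (w ∈? h) ×-dec (d w * ∣ h ∣ ≤? s))
... | yes below = below
... | no ¬below = ⊥-elim (<-irrefl refl (begin-strict
  s * ∣ h ∣                                  <⟨ +-monoˡ-< (s * ∣ h ∣) 0<∣h∣ ⟩
  ∣ h ∣ + s * ∣ h ∣                          ≡⟨ *-comm (suc s) ∣ h ∣ ⟩
  ∣ h ∣ * suc s                              ≡⟨ cong (_* suc s) (∣p∣≡∑ h) ⟩
  sum (λ w → ⟦ does (w ∈? h) ⟧) * suc s      ≡⟨ *-distribʳ-sum (suc s) (λ w → ⟦ does (w ∈? h) ⟧) ⟩
  sum (λ w → ⟦ does (w ∈? h) ⟧ * suc s)      ≤⟨ ∑-mono-≤ above ⟩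
  sum (λ w → d w * ∣ h ∣)                    ≡⟨ *-distribʳ-sum ∣ h ∣ d ⟨
  sum d * ∣ h ∣                              ≤⟨ *-monoˡ-≤ ∣ h ∣ ∑d≤s ⟩
  s * ∣ h ∣                                  ∎))
  where
  open ≤-Reasoning
  above : ∀ w → ⟦ does (w ∈? h) ⟧ * suc s ≤ d w * ∣ h ∣
  above w with w ∈? h
  ... | no _ = z≤n
  ... | yes w∈h with d w * ∣ h ∣ ≤? s
  ...   | yes dw≤s = ⊥-elim (¬below (w , w∈h , dw≤s))
  ...   | no dw≰s = ≤-trans (≤-reflexive (+-identityʳ (suc s))) (≰⇒> dw≰s)

length-filter≡∑ : ∀ {A : Set} {P : A → Set} (P? : Decidable P) (xs : List A) →
  length (filter P? xs) ≡ ∑[ i < length xs ] ⟦ does (P? (lookup xs i)) ⟧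
length-filter≡∑ P? [] = refl
length-filter≡∑ P? (x ∷ xs) with does (P? x)
... | true = cong suc (length-filter≡∑ P? xs)
... | false = length-filter≡∑ P? xs

2*[1+n]C2≡[1+n]*n : ∀ n → 2 * (suc n C 2) ≡ suc n * n
2*[1+n]C2≡[1+n]*n zero = refl
2*[1+n]C2≡[1+n]*n (suc n) = begin
  2 * (suc (suc n) C 2)           ≡⟨ cong (2 *_) (nCk+nC[k+1]≡[n+1]C[k+1] (suc n) 1) ⟨
  2 * (suc n C 1 + suc n C 2)     ≡⟨ cong (λ c → 2 * (c + suc n C 2)) (nC1≡n (suc n)) ⟩
  2 * (suc n + suc n C 2)         ≡⟨ *-distribˡ-+ 2 (suc n) (suc n C 2) ⟩
  2 * suc n + 2 * (suc n C 2)     ≡⟨ cong (2 * suc n +_) (2*[1+n]C2≡[1+n]*n n) ⟩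
  2 * suc n + suc n * n           ≡⟨ regroup n ⟩
  suc (suc n) * suc n             ∎
  where
  open ≡-Reasoning
  regroup : ∀ n → 2 * suc n + suc n * n ≡ suc (suc n) * suc n
  regroup = solve-∀

2*nC2≡n*[n∸1] : ∀ n → 2 * (n C 2) ≡ n * (n ∸ 1)
2*nC2≡n*[n∸1] zero = refl
2*nC2≡n*[n∸1] (suc n) = 2*[1+n]C2≡[1+n]*n n

m≤n⇒mC2≤nC2 : ∀ {m n} → m ≤ n → m C 2 ≤ n C 2
m≤n⇒mC2≤nC2 {m} {n} m≤n = *-cancelˡ-≤ 2 (begin
  2 * (m C 2)  ≡⟨ 2*nC2≡n*[n∸1] m ⟩
  m * (m ∸ 1)  ≤⟨ *-mono-≤ m≤n (∸-monoˡ-≤ 1 m≤n) ⟩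
  n * (n ∸ 1)  ≡⟨ 2*nC2≡n*[n∸1] n ⟨
  2 * (n C 2)  ∎)
  where open ≤-Reasoning

2≤n⇒0<nC2 : ∀ {n} → 2 ≤ n → 0 < n C 2
2≤n⇒0<nC2 {suc (suc n)} (s≤s (s≤s z≤n)) = *-cancelˡ-< 2 0 _ (begin-strict
  0                    <⟨ s≤s z≤n ⟩
  suc (suc n) * suc n  ≡⟨ 2*[1+n]C2≡[1+n]*n (suc n) ⟨
  2 * (suc (suc n) C 2) ∎)
  where open ≤-Reasoning

-- Multiplied by 2 this is (a + d) s (s - 1) ≤ a (s + 1) s, i.e. d (s - 1) ≤ 2 a.
d[1+s]≤2[a+d]⇒[a+d]sC2≤a[1+s]C2 : ∀ a d s → d * suc s ≤ 2 * (a + d) →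
  (a + d) * (s C 2) ≤ a * (suc s C 2)
d[1+s]≤2[a+d]⇒[a+d]sC2≤a[1+s]C2 a d zero _ = ≤-trans (≤-reflexive (*-zeroʳ (a + d))) z≤n
d[1+s]≤2[a+d]⇒[a+d]sC2≤a[1+s]C2 a d (suc t) hyp = *-cancelˡ-≤ 2 (begin
  2 * ((a + d) * (suc t C 2))      ≡⟨ x∙yz≈y∙xz 2 (a + d) (suc t C 2) ⟩
  (a + d) * (2 * (suc t C 2))      ≡⟨ cong ((a + d) *_) (2*[1+n]C2≡[1+n]*n t) ⟩
  (a + d) * (suc t * t)            ≡⟨ expand a d t ⟩
  suc t * (a * t + d * t)          ≤⟨ *-monoʳ-≤ (suc t) (+-monoʳ-≤ (a * t) dt≤2a) ⟩
  suc t * (a * t + 2 * a)          ≡⟨ collect a t ⟩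
  a * (suc (suc t) * suc t)        ≡⟨ cong (a *_) (2*[1+n]C2≡[1+n]*n (suc t)) ⟨
  a * (2 * (suc (suc t) C 2))      ≡⟨ x∙yz≈y∙xz a 2 (suc (suc t) C 2) ⟩
  2 * (a * (suc (suc t) C 2))      ∎)
  where
  open ≤-Reasoning
  expand : ∀ a d t → (a + d) * (suc t * t) ≡ suc t * (a * t + d * t)
  expand = solve-∀
  collect : ∀ a t → suc t * (a * t + 2 * a) ≡ a * (suc (suc t) * suc t)
  collect = solve-∀
  collect-d : ∀ d t → d * t + 2 * d ≡ d * suc (suc t)
  collect-d = solve-∀
  dt≤2a : d * t ≤ 2 * a
  dt≤2a = +-cancelʳ-≤ (2 * d) (d * t) (2 * a) (begin
    d * t + 2 * d  ≡⟨ collect-d d t ⟩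
    d * suc (suc t) ≤⟨ hyp ⟩
    2 * (a + d)    ≡⟨ *-distribˡ-+ 2 a d ⟩
    2 * a + 2 * d  ∎)

aB≤bD∧bA≤cB⇒aA≤cD : ∀ a b c {A B D} → 0 < B → a * B ≤ b * D → b * A ≤ c * B → a * A ≤ c * D
aB≤bD∧bA≤cB⇒aA≤cD a b c {A} {B} {D} 0<B aB≤bD bA≤cB = *-cancelʳ-≤ (a * A) (c * D) B {{>-nonZero 0<B}} (begin
  a * A * B  ≡⟨ xy∙z≈xz∙y a A B ⟩
  a * B * A  ≤⟨ *-monoˡ-≤ A aB≤bD ⟩
  b * D * A  ≡⟨ xy∙z≈xz∙y b D A ⟩
  b * A * D  ≤⟨ *-monoˡ-≤ D bA≤cB ⟩
  c * B * D  ≡⟨ xy∙z≈xz∙y c B D ⟩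
  c * D * B  ∎)
  where open ≤-Reasoning

Unique⇒lookup-injective : ∀ {A : Set} {xs : List A} → Unique xs → Injective _≡_ _≡_ (lookup xs)
Unique⇒lookup-injective (x∉xs ∷ _) {zero} {zero} _ = refl
Unique⇒lookup-injective (x∉xs ∷ _) {zero} {suc j} x≡xsⱼ = ⊥-elim (All.lookup x∉xs (∈-lookup j) x≡xsⱼ)
Unique⇒lookup-injective (x∉xs ∷ _) {suc i} {zero} xsᵢ≡x = ⊥-elim (All.lookup x∉xs (∈-lookup i) (sym xsᵢ≡x))
Unique⇒lookup-injective (_ ∷ xs!) {suc i} {suc j} xsᵢ≡xsⱼ = cong suc (Unique⇒lookup-injective xs! xsᵢ≡xsⱼ)

infix 4 _≼_

record _≼_ {n} (E' E : List (Subset n)) : Set where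
  constructor embedding
  field
    position : Fin (length E') → Fin (length E)
    position-injective : Injective _≡_ _≡_ position
    ⊆-position : ∀ k → lookup E' k ⊆ lookup E (position k)

[]≼ : ∀ {n} {E : List (Subset n)} → [] ≼ E
[]≼ = embedding (λ ()) (λ { {()} }) (λ ())

∷-≼ : ∀ {n} {h' h : Subset n} {E' E} → h' ⊆ h → E' ≼ E → h' ∷ E' ≼ h ∷ E
∷-≼ {h' = h'} {h} {E'} {E} h'⊆h (embedding f f-injective E'⊆E) = embedding g g-injective h'∷E'⊆h∷E
  where
  g : Fin (suc (length E')) → Fin (suc (length E))
  g zero = zero
  g (suc k) = suc (f k)
  g-injective : Injective _≡_ _≡_ g
  g-injective {zero} {zero} _ = refl
  g-injective {suc k} {suc k'} gk≡gk' = cong suc (f-injective (Fin.suc-injective gk≡gk'))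
  h'∷E'⊆h∷E : ∀ k → lookup (h' ∷ E') k ⊆ lookup (h ∷ E) (g k)
  h'∷E'⊆h∷E zero = h'⊆h
  h'∷E'⊆h∷E (suc k) = E'⊆E k

≼-trans : ∀ {n} {E'' E' E : List (Subset n)} → E'' ≼ E' → E' ≼ E → E'' ≼ E
≼-trans (embedding f f-injective E''⊆E') (embedding g g-injective E'⊆E) =
  embedding (g ∘ f) (f-injective ∘ g-injective) (λ k → E'⊆E (f k) ∘ E''⊆E' k)

Unique∧⊆⇒≼ : ∀ {n} {E' E : List (Subset n)} → Unique E' → E' ⊆ₗ E → E' ≼ E
Unique∧⊆⇒≼ {E' = E'} {E} E'! E'⊆E = embedding f f-injective (λ k → ⊆-reflexive (Any.lookup-index (E'⊆E (∈-lookup k))))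
  where
  f : Fin (length E') → Fin (length E)
  f k = index (E'⊆E (∈-lookup k))
  f-injective : Injective _≡_ _≡_ f
  f-injective {k} {k'} fk≡fk' = Unique⇒lookup-injective E'! (begin
    lookup E' k         ≡⟨ Any.lookup-index (E'⊆E (∈-lookup k)) ⟩
    lookup E (f k)      ≡⟨ cong (lookup E) fk≡fk' ⟩
    lookup E (f k')     ≡⟨ Any.lookup-index (E'⊆E (∈-lookup k')) ⟨
    lookup E' k'        ∎)
    where open ≡-Reasoning

ContainsBerge-≼ : ∀ {n} (G : Graph) {H' H : Hypergraph n} →
  edges H' ≼ edges H → ContainsBerge G H' → ContainsBerge G H
ContainsBerge-≼ G (embedding g g-injective H'⊆H) (i , f , i-injective , f-injective , uv⊆f) =
  i , g ∘ f , i-injective , f-injective ∘ g-injective , (λ j u u∈j → H'⊆H (f j) (uv⊆f j u u∈j))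

Pair : ℕ → Set
Pair n = Fin n × Fin n

pairIn? : ∀ {n} (h : Subset n) (p : Pair n) → Dec (proj₁ p ∈ₛ h × proj₂ p ∈ₛ h)
pairIn? h (u , v) = (u ∈? h) ×-dec (v ∈? h)

pairIn : ∀ {n} → Subset n → Pair n → Bool
pairIn h p = does (pairIn? h p)

pairIn-mono : ∀ {n} {h' h : Subset n} → h' ⊆ h → ∀ p → T (pairIn h' p) → T (pairIn h p)
pairIn-mono {h' = h'} {h} h'⊆h p =
  A⇒T-does (pairIn? h p) ∘ Product.map h'⊆h h'⊆h ∘ T-does⇒A (pairIn? h' p)

-- A pair leaves h - w only if w is one of its two ends.
∑-⟦¬pairIn[h-w]⟧≤2 : ∀ {n} (h : Subset n) c (p : Pair n) → (T c → T (pairIn h p)) →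
  ∑[ w < n ] ⟦ c ∧ not (pairIn (h - w) p) ⟧ ≤ 2 * ⟦ c ⟧
∑-⟦¬pairIn[h-w]⟧≤2 {n} h false p _ = ≤-reflexive (sum-replicate-zero n)
∑-⟦¬pairIn[h-w]⟧≤2 {n} h true (u , v) c⇒uv∈h = begin
  ∑[ w < n ] ⟦ not (pairIn (h - w) (u , v)) ⟧   ≤⟨ ∑-mono-≤ removes-u-or-v ⟩
  ∑[ w < n ] (δ u w + δ v w)                   ≡⟨ ∑-distrib-+ (δ u) (δ v) ⟩
  ∑[ w < n ] δ u w + ∑[ w < n ] δ v w          ≡⟨ cong₂ _+_ (∑-δ u) (∑-δ v) ⟩
  2                                            ∎
  where
  open ≤-Reasoning
  δ : Fin n → Fin n → ℕ
  δ x w = ⟦ does (x Fin.≟ w) ⟧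
  u∈h×v∈h : u ∈ₛ h × v ∈ₛ h
  u∈h×v∈h = T-does⇒A (pairIn? h (u , v)) (c⇒uv∈h _)
  removes-u-or-v : ∀ w → ⟦ not (pairIn (h - w) (u , v)) ⟧ ≤ δ u w + δ v w
  removes-u-or-v w with u Fin.≟ w | v Fin.≟ w
  ... | yes _ | _ = ≤-trans (⟦b⟧≤1 _) (m≤m+n 1 _)
  ... | no _ | yes _ = ⟦b⟧≤1 _
  ... | no u≢w | no v≢w = ≤-reflexive (T⇒⟦not⟧≡0 (A⇒T-does (pairIn? (h - w) (u , v))
          (x∈p∧x≢y⇒x∈p-y (proj₁ u∈h×v∈h) u≢w , x∈p∧x≢y⇒x∈p-y (proj₂ u∈h×v∈h) v≢w)))

_≟ₛ_ : ∀ {n} → DecidableEquality (Subset n)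
_≟ₛ_ = ≡-dec Bool._≟_

covers : ∀ {n} → List (Subset n) → Pair n → Bool
covers E p = does (any? (λ h → pairIn? h p) E)

covers-deduplicate : ∀ {n} (E : List (Subset n)) p → T (covers E p) → T (covers (deduplicate _≟ₛ_ E) p)
covers-deduplicate E p t = A⇒T-does (any? (λ h → pairIn? h p) _)
  (Any.deduplicate⁺ _≟ₛ_ (λ { refl p∈h → p∈h }) (T-does⇒A (any? (λ h → pairIn? h p) E) t))

module _ {n : ℕ} (P : List (Pair n)) where

  count : (Pair n → Bool) → ℕ
  count q = ∑[ i < length P ] ⟦ q (lookup P i) ⟧

  count-mono : ∀ (q q' : Pair n → Bool) → (∀ p → T (q p) → T (q' p)) → count q ≤ count q'
  count-mono q q' q⇒q' = ∑-mono-≤ (λ i → T⇒⟦⟧≤ (q⇒q' (lookup P i)))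

  edgesIn : (Pair n → Bool) → Subset n → ℕ
  edgesIn q h = count (λ p → q p ∧ pairIn h p)

  degree : (Pair n → Bool) → Subset n → Fin n → ℕ
  degree q h w = count (λ p → (q p ∧ pairIn h p) ∧ not (pairIn (h - w) p))

  edgesIn-remove : ∀ q h w → edgesIn q h ≡ edgesIn q (h - w) + degree q h w
  edgesIn-remove q h w = trans
    (sum-cong-≗ (λ i → let p = lookup P i in
      ⟦q∧a⟧≡⟦q∧b⟧+⟦q∧a∧¬b⟧ (q p) (pairIn h p) (pairIn (h - w) p) (pairIn-mono (p─q⊆p h _) p)))
    (∑-distrib-+ (λ i → ⟦ q (lookup P i) ∧ pairIn (h - w) (lookup P i) ⟧) _)

  ∑-degree≤2*edgesIn : ∀ q h → ∑[ w < n ] degree q h w ≤ 2 * edgesIn q h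
  ∑-degree≤2*edgesIn q h = begin
    ∑[ w < n ] ∑[ i < length P ] removed w (lookup P i)  ≡⟨ ∑-comm (λ w i → removed w (lookup P i)) ⟩
    ∑[ i < length P ] ∑[ w < n ] removed w (lookup P i)  ≤⟨ ∑-mono-≤ (λ i → at-most-two (lookup P i)) ⟩
    ∑[ i < length P ] (2 * ⟦ charged (lookup P i) ⟧)      ≡⟨ *-distribˡ-sum 2 (λ i → ⟦ charged (lookup P i) ⟧) ⟨
    2 * edgesIn q h                                      ∎
    where
    open ≤-Reasoning
    charged : Pair n → Bool
    charged p = q p ∧ pairIn h p
    removed : Fin n → Pair n → ℕ
    removed w p = ⟦ charged p ∧ not (pairIn (h - w) p) ⟧
    at-most-two : ∀ p → ∑[ w < n ] removed w p ≤ 2 * ⟦ charged p ⟧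
    at-most-two p = ∑-⟦¬pairIn[h-w]⟧≤2 h (charged p) p (proj₂ ∘ Equivalence.to (T-∧ {q p}))

  ∃-remove-vertex : ∀ q h {s} → ∣ h ∣ ≡ suc s →
    ∃ λ w → w ∈ₛ h × edgesIn q h * (s C 2) ≤ edgesIn q (h - w) * (suc s C 2)
  ∃-remove-vertex q h {s} ∣h∣≡1+s
    with w , w∈h , d*∣h∣≤2e ← ∃-below-average h (degree q h)
                                (subst (0 <_) (sym ∣h∣≡1+s) (s≤s z≤n)) (∑-degree≤2*edgesIn q h)
    rewrite edgesIn-remove q h w | ∣h∣≡1+s
    = w , w∈h , d[1+s]≤2[a+d]⇒[a+d]sC2≤a[1+s]C2 (edgesIn q (h - w)) (degree q h w) s d*∣h∣≤2e

  shrink : ∀ {m} → 2 ≤ m → ∀ q h → m ≤ ∣ h ∣ →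
    ∃ λ h' → h' ⊆ h × ∣ h' ∣ ≡ m × edgesIn q h * (m C 2) ≤ edgesIn q h' * (∣ h ∣ C 2)
  shrink {m} 2≤m q h m≤∣h∣ =
    subst (λ s → ∃ λ h' → h' ⊆ h × ∣ h' ∣ ≡ m × edgesIn q h * (m C 2) ≤ edgesIn q h' * (s C 2))
      (m∸n+n≡m m≤∣h∣) (shrinkBy (∣ h ∣ ∸ m) h (sym (m∸n+n≡m m≤∣h∣)))
    where
    shrinkBy : ∀ k h → ∣ h ∣ ≡ k + m →
      ∃ λ h' → h' ⊆ h × ∣ h' ∣ ≡ m × edgesIn q h * (m C 2) ≤ edgesIn q h' * ((k + m) C 2)
    shrinkBy zero h ∣h∣≡m = h , id , ∣h∣≡m , ≤-refl
    shrinkBy (suc k) h ∣h∣≡1+k+m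
      with w , w∈h , step ← ∃-remove-vertex q h ∣h∣≡1+k+m
      with h' , h'⊆h-w , ∣h'∣≡m , shrunk ←
             shrinkBy k (h - w) (suc-injective (trans (x∈p⇒∣p-x∣+1≡∣p∣ w∈h) ∣h∣≡1+k+m))
      = h' , p─q⊆p h _ ∘ h'⊆h-w , ∣h'∣≡m ,
        aB≤bD∧bA≤cB⇒aA≤cD (edgesIn q h) (edgesIn q (h - w)) (edgesIn q h')
          (2≤n⇒0<nC2 (≤-trans 2≤m (m≤n+m m k))) step shrunk


  count-covers-∷ : ∀ (q : Pair n → Bool) h E → count (λ p → q p ∧ covers (h ∷ E) p) ≡
    edgesIn q h + count (λ p → (q p ∧ not (pairIn h p)) ∧ covers E p)
  count-covers-∷ q h E = trans
    (sum-cong-≗ (λ i → let p = lookup P i in ⟦q∧[a∨b]⟧≡⟦q∧a⟧+⟦q∧¬a∧b⟧ (q p) (pairIn h p) (covers E p)))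
    (∑-distrib-+ (λ i → ⟦ q (lookup P i) ∧ pairIn h (lookup P i) ⟧) _)

  count-covers-[] : ∀ (q : Pair n → Bool) → count (λ p → q p ∧ covers [] p) ≡ 0
  count-covers-[] q = n≤0⇒n≡0 (begin
    count (λ p → q p ∧ covers [] p)  ≤⟨ count-mono _ _ (λ p → proj₂ ∘ Equivalence.to (T-∧ {q p})) ⟩
    count (λ _ → false)              ≡⟨ sum-replicate-zero (length P) ⟩
    0                                ∎)
    where open ≤-Reasoning

  -- q marks the pairs not covered by earlier edges, so each shadow pair is charged to the
  -- first edge containing it.
  shrinkAll : ∀ {m M} → 2 ≤ m → ∀ (q : Pair n → Bool) (E : List (Subset n)) → All (λ h → m ≤ ∣ h ∣ × ∣ h ∣ ≤ M) E →
    ∃ λ E' → All (λ h → ∣ h ∣ ≡ m) E' × E' ≼ E ×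
      count (λ p → q p ∧ covers E p) * (m C 2) ≤ count (λ p → q p ∧ covers E' p) * (M C 2)
  shrinkAll {m} {M} 2≤m q [] [] = [] , [] , []≼ , ≤-reflexive (begin
    count (λ p → q p ∧ covers [] p) * (m C 2) ≡⟨ cong (_* (m C 2)) (count-covers-[] q) ⟩
    0                                           ≡⟨ cong (_* (M C 2)) (count-covers-[] q) ⟨
    count (λ p → q p ∧ covers [] p) * (M C 2) ∎)
    where open ≡-Reasoning
  shrinkAll {m} {M} 2≤m q (h ∷ E) ((m≤∣h∣ , ∣h∣≤M) ∷ bounds)
    with h' , h'⊆h , ∣h'∣≡m , h-shrunk ← shrink 2≤m q h m≤∣h∣
    with E' , ∣E'∣≡m , E'≼E , E-shrunk ← shrinkAll 2≤m (λ p → q p ∧ not (pairIn h p)) E bounds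
    = h' ∷ E' , ∣h'∣≡m ∷ ∣E'∣≡m , ∷-≼ h'⊆h E'≼E , (begin
      count (λ p → q p ∧ covers (h ∷ E) p) * (m C 2)
        ≡⟨ cong (_* (m C 2)) (count-covers-∷ q h E) ⟩
      (edgesIn q h + count (λ p → (q p ∧ not (pairIn h p)) ∧ covers E p)) * (m C 2)
        ≡⟨ *-distribʳ-+ (m C 2) (edgesIn q h) _ ⟩
      edgesIn q h * (m C 2) + count (λ p → (q p ∧ not (pairIn h p)) ∧ covers E p) * (m C 2)
        ≤⟨ +-mono-≤ (≤-trans h-shrunk (*-monoʳ-≤ (edgesIn q h') (m≤n⇒mC2≤nC2 ∣h∣≤M))) E-shrunk ⟩
      edgesIn q h' * (M C 2) + count (λ p → (q p ∧ not (pairIn h p)) ∧ covers E' p) * (M C 2)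
        ≤⟨ +-monoʳ-≤ (edgesIn q h' * (M C 2)) (*-monoˡ-≤ (M C 2) (count-mono _ _ uncovered-by-h⇒uncovered-by-h')) ⟩
      edgesIn q h' * (M C 2) + count (λ p → (q p ∧ not (pairIn h' p)) ∧ covers E' p) * (M C 2)
        ≡⟨ *-distribʳ-+ (M C 2) (edgesIn q h') _ ⟨
      (edgesIn q h' + count (λ p → (q p ∧ not (pairIn h' p)) ∧ covers E' p)) * (M C 2)
        ≡⟨ cong (_* (M C 2)) (count-covers-∷ q h' E') ⟨
      count (λ p → q p ∧ covers (h' ∷ E') p) * (M C 2) ∎)
    where
    open ≤-Reasoning
    uncovered : Subset n → Pair n → Bool
    uncovered g p = (q p ∧ not (pairIn g p)) ∧ covers E' p
    uncovered-by-h⇒uncovered-by-h' : ∀ p → T (uncovered h p) → T (uncovered h' p)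
    uncovered-by-h⇒uncovered-by-h' p = T-[q∧¬a]∧c-antitone (q p) (covers E' p) (pairIn-mono h'⊆h p)

-- covers unfolds to the very test that shadowSize filters by.
shadowSize≡count : ∀ {n} (H : Hypergraph n) → shadowSize H ≡ count (pairsLt n) (covers (edges H))
shadowSize≡count {n} H = length-filter≡∑ _ (pairsLt n)

shrinkHypergraph : ∀ {n m M} → 2 ≤ m → (H : Hypergraph n) → All (λ h → m ≤ ∣ h ∣ × ∣ h ∣ ≤ M) (edges H) →
  ∃ λ H' → IsRGraph [ m ] H' × edges H' ≼ edges H × shadowSize H * (m C 2) ≤ shadowSize H' * (M C 2)
shrinkHypergraph {n} {m} {M} 2≤m H bounds
  with E' , ∣E'∣≡m , E'≼E , shrunk ← shrinkAll (pairsLt n) 2≤m (λ _ → true) (edges H) bounds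
  = H' , All.deduplicate⁺ _≟ₛ_ (All.map here ∣E'∣≡m) ,
    ≼-trans (Unique∧⊆⇒≼ (deduplicate-! _≟ₛ_ E') (Any.deduplicate⁻ _≟ₛ_)) E'≼E , (begin
    shadowSize H * (m C 2)                            ≡⟨ cong (_* (m C 2)) (shadowSize≡count H) ⟩
    count (pairsLt n) (covers (edges H)) * (m C 2)    ≤⟨ shrunk ⟩
    count (pairsLt n) (covers E') * (M C 2)           ≤⟨ *-monoˡ-≤ (M C 2) (count-mono (pairsLt n) _ _ (covers-deduplicate E')) ⟩
    count (pairsLt n) (covers (edges H')) * (M C 2)   ≡⟨ cong (_* (M C 2)) (shadowSize≡count H') ⟨
    shadowSize H' * (M C 2)                           ∎)
  where
  open ≤-Reasoning
  H' : Hypergraph n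
  H' = hypergraph (deduplicate _≟ₛ_ E') (deduplicate-! _≟ₛ_ E')

IsRGraph-∈ : ∀ {n} {R : List ℕ} {r} {H : Hypergraph n} → r ∈ R → IsRGraph [ r ] H → IsRGraph R H
IsRGraph-∈ r∈R = All.map λ { (here refl) → r∈R }

proposition1 : (R : List ℕ) (m M : ℕ) → 2 ≤ m → m ∈ R → All (m ≤_) R → M ∈ R → All (_≤ M) R →
    (G : Graph) (n : ℕ) (exR exm : ℕ) →
    IsCoverTuran R n G exR → IsCoverTuran [ m ] n G exm →
    (∀ (r exr : ℕ) → r ∈ R → IsCoverTuran [ r ] n G exr → exr ≤ exR) ×
    (exR * (m C 2) ≤ (M C 2) * exm)
proposition1 R m M 2≤m _ m≤R _ R≤M G n exR exm ((H , H-R , H-free , ∂H≡exR) , exR-max) (_ , exm-max) =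
  exr≤exR , exR*mC2≤MC2*exm
  where
  exr≤exR : ∀ r exr → r ∈ R → IsCoverTuran [ r ] n G exr → exr ≤ exR
  exr≤exR r exr r∈R ((Hᵣ , Hᵣ-r , Hᵣ-free , ∂Hᵣ≡exr) , _) =
    subst (_≤ exR) ∂Hᵣ≡exr (exR-max Hᵣ (IsRGraph-∈ {H = Hᵣ} r∈R Hᵣ-r) Hᵣ-free)
  edge-sizes : All (λ h → m ≤ ∣ h ∣ × ∣ h ∣ ≤ M) (edges H)
  edge-sizes = All.map (λ ∣h∣∈R → All.lookup m≤R ∣h∣∈R , All.lookup R≤M ∣h∣∈R) H-R
  exR*mC2≤MC2*exm : exR * (m C 2) ≤ (M C 2) * exm
  exR*mC2≤MC2*exm with H' , H'-m , H'≼H , shrunk ← shrinkHypergraph 2≤m H edge-sizes = begin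
    exR * (m C 2)            ≡⟨ cong (_* (m C 2)) ∂H≡exR ⟨
    shadowSize H * (m C 2)   ≤⟨ shrunk ⟩
    shadowSize H' * (M C 2)  ≤⟨ *-monoˡ-≤ (M C 2) (exm-max H' H'-m (H-free ∘ ContainsBerge-≼ G {H'} {H} H'≼H)) ⟩
    exm * (M C 2)            ≡⟨ *-comm exm (M C 2) ⟩
    (M C 2) * exm            ∎
    where open ≤-Reasoning
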